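{- Let $G$ be a two-rooted graph with roots $x,y$, and let $G'=\textbf{gcds}_{\{p,q\}}(G)$ for adjacent non-root vertices $p,q$. Then $G$ has a generalized parity cut $V_1$ with $V_1\cap\{x,y\}=\{x\}$ and a generalized parity cut $V_2$ with $V_2\cap\{x,y\}=\{y\}$ if and only if $G'$ has such a pair of generalized parity cuts.
   Context: A two-rooted graph is a finite simple undirected graph $G=(V,E)$ with two designated roots. A generalized parity cut of $G$ is a subset $U\subseteq V$ such that every vertex $v\in V$ has an even number of neighbours in $U$. With $f_a(b)=1$ iff $a,b$ adjacent, $\textbf{gcds}_{\{p,q\}}(G)$ is the graph on $V$ where distinct $s,t$ are adjacent iff $f_p(s)f_q(t)+f_q(s)f_p(t)+f_s(t)\equiv1\pmod 2$. -}

module Defs where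

open import Data.Nat using (ℕ; zero; suc; _+_)
open import Data.Nat.Properties using ()
open import Data.Bool using (Bool; true; false; _∧_; _xor_; if_then_else_)
open import Data.Fin using (Fin; _≟_)
open import Data.Product using (_×_; Σ; ∃-syntax)
open import Relation.Nullary using (¬_; yes; no)
open import Relation.Binary.PropositionalEquality using (_≡_; _≢_)

record Graph (n : ℕ) : Set where
  field
    adj       : Fin n → Fin n → Bool
    adj-sym   : ∀ u v → adj u v ≡ adj v u
    adj-irrefl : ∀ v → adj v v ≡ false
open Graph public

record TwoRootedGraph (n : ℕ) : Set where
  field
    graph : Graph n
    root₁ : Fin n
    root₂ : Fin n
    roots-distinct : root₁ ≢ root₂
open TwoRootedGraph public

count : ∀ {n} → (Fin n → Bool) → ℕ
count {zero}  P = 0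
count {suc n} P = (if P Fin.zero then 1 else 0) + count (λ i → P (Fin.suc i))
  where import Data.Fin as Fin

data Even : ℕ → Set where
  even-zero : Even 0
  even-ss   : ∀ {m} → Even m → Even (suc (suc m))

Subset : ℕ → Set
Subset n = Fin n → Bool

IsGeneralizedParityCut : ∀ {n} → Graph n → Subset n → Set
IsGeneralizedParityCut G U = ∀ v → Even (count (λ u → adj G v u ∧ U u))

gcdsAdj : ∀ {n} → Graph n → Fin n → Fin n → Fin n → Fin n → Bool
gcdsAdj G p q s t with s ≟ t
... | yes _ = false
... | no  _ = ((adj G p s ∧ adj G q t) xor (adj G q s ∧ adj G p t)) xor adj G s t

HasRootedParityCutPair : ∀ {n} → Graph n → Fin n → Fin n → Set
HasRootedParityCutPair G x y =
  (∃[ V₁ ] (IsGeneralizedParityCut G V₁ × V₁ x ≡ true × V₁ y ≡ false)) ×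
  (∃[ V₂ ] (IsGeneralizedParityCut G V₂ × V₂ x ≡ false × V₂ y ≡ true))

-- Work over GF(2): a generalized parity cut of G is a vector U with A U = 0, where A is the
-- adjacency matrix, and gcds_{p,q} replaces A by A' = A + a_p a_qᵀ + a_q a_pᵀ (a_v the row of v).
-- A cut U of G has a_p · U = a_q · U = 0, so A' U = A U = 0.  Conversely, if A' U = 0 then
-- U + (a_q · U) e_p + (a_p · U) e_q is a cut of G; it agrees with U outside {p, q}, so in
-- particular on the roots.
module Submission where

open import Defs
open import Algebra.Bundles using (CommutativeRing)
open import Data.Bool using (Bool; true; false; not; _∧_; _xor_; if_then_else_)
open import Data.Bool.Properties
  using (xor-∧-commutativeRing; xor-comm; xor-same; xor-identityʳ;
         not-distribˡ-xor; not-involutive; ∧-comm; ∧-assoc; ∧-zeroʳ; ∧-identityʳ; ∧-distribʳ-xor)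
open import Data.Fin using (Fin; zero; suc)
open import Data.Fin.Properties using (_≟_)
open import Data.Nat using (ℕ; zero; suc; _+_)
open import Data.Product using (_,_)
open import Function using (_∘_; id)
open import Function.Bundles using (_⇔_; mk⇔; Equivalence)
open import Relation.Nullary using (Dec; does; yes; no)
open import Relation.Nullary.Decidable using (dec-false)
open import Relation.Binary.PropositionalEquality
  using (_≡_; _≢_; ≢-sym; refl; sym; trans; cong; cong₂; module ≡-Reasoning)

open import Algebra.Properties.Semiring.Sum (CommutativeRing.semiring xor-∧-commutativeRing)
  using (sum; sum-cong-≗; sum-replicate-zero; ∑-distrib-+; *-distribˡ-sum)

open ≡-Reasoning

isOdd : ℕ → Bool
isOdd zero    = false
isOdd (suc m) = not (isOdd m)

isOdd-+ : ∀ m n → isOdd (m + n) ≡ isOdd m xor isOdd n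
isOdd-+ zero    n = refl
isOdd-+ (suc m) n = trans (cong not (isOdd-+ m n)) (not-distribˡ-xor (isOdd m) (isOdd n))

isOdd-count : ∀ {n} (P : Fin n → Bool) → isOdd (count P) ≡ sum P
isOdd-count {zero}  P = refl
isOdd-count {suc n} P = trans (isOdd-+ (if P zero then 1 else 0) _)
                              (cong₂ _xor_ (isOdd-indicator (P zero)) (isOdd-count (P ∘ suc)))
  where
  isOdd-indicator : ∀ b → isOdd (if b then 1 else 0) ≡ b
  isOdd-indicator false = refl
  isOdd-indicator true  = refl

Even⇔isOdd≡false : ∀ m → Even m ⇔ isOdd m ≡ false
Even⇔isOdd≡false m = mk⇔ even⇒ (⇒even m)
  where
  even⇒ : ∀ {m} → Even m → isOdd m ≡ false
  even⇒ even-zero   = refl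
  even⇒ (even-ss e) = cong (not ∘ not) (even⇒ e)
  ⇒even : ∀ m → isOdd m ≡ false → Even m
  ⇒even zero          _     = even-zero
  ⇒even (suc zero)    ()
  ⇒even (suc (suc m)) odd≡f = even-ss (⇒even m (trans (sym (not-involutive (isOdd m))) odd≡f))

infixl 6 _⊕_
infixr 7 _⊛_
infix  5 _·_

_⊕_ : ∀ {n} → Subset n → Subset n → Subset n
(f ⊕ g) u = f u xor g u

_⊛_ : ∀ {n} → Bool → Subset n → Subset n
(c ⊛ f) u = c ∧ f u

_·_ : ∀ {n} → Subset n → Subset n → Bool
f · g = sum (λ u → f u ∧ g u)

δ : ∀ {n} → Fin n → Subset n
δ p u = does (u ≟ p)

·-comm : ∀ {n} (f g : Subset n) → (f · g) ≡ (g · f)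
·-comm f g = sum-cong-≗ (λ u → ∧-comm (f u) (g u))

·-distribˡ-⊕ : ∀ {n} (f g h : Subset n) → (f ⊕ g · h) ≡ (f · h) xor (g · h)
·-distribˡ-⊕ f g h = trans (sum-cong-≗ (λ u → ∧-distribʳ-xor (h u) (f u) (g u)))
                           (∑-distrib-+ (λ u → f u ∧ h u) (λ u → g u ∧ h u))

·-distribʳ-⊕ : ∀ {n} (f g h : Subset n) → (f · g ⊕ h) ≡ (f · g) xor (f · h)
·-distribʳ-⊕ f g h = begin
  (f · g ⊕ h)             ≡⟨ ·-comm f (g ⊕ h) ⟩
  (g ⊕ h · f)             ≡⟨ ·-distribˡ-⊕ g h f ⟩
  (g · f) xor (h · f)     ≡⟨ cong₂ _xor_ (·-comm g f) (·-comm h f) ⟩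
  (f · g) xor (f · h)     ∎

·-scaleˡ : ∀ {n} c (f g : Subset n) → (c ⊛ f · g) ≡ c ∧ (f · g)
·-scaleˡ c f g = trans (sum-cong-≗ (λ u → ∧-assoc c (f u) (g u)))
                       (sym (*-distribˡ-sum c (λ u → f u ∧ g u)))

·-scaleʳ : ∀ {n} c (f g : Subset n) → (f · c ⊛ g) ≡ c ∧ (f · g)
·-scaleʳ c f g = trans (·-comm f (c ⊛ g)) (trans (·-scaleˡ c g f) (cong (c ∧_) (·-comm g f)))

·-δ : ∀ {n} (f : Subset n) p → (f · δ p) ≡ f p
·-δ {suc n} f zero    = begin
  (f zero ∧ true) xor sum (λ u → f (suc u) ∧ false) ≡⟨ cong₂ _xor_ (∧-identityʳ (f zero)) (sum-cong-≗ (∧-zeroʳ ∘ f ∘ suc)) ⟩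
  f zero xor sum {n} (λ _ → false)                   ≡⟨ cong (f zero xor_) (sum-replicate-zero n) ⟩
  f zero xor false                                   ≡⟨ xor-identityʳ (f zero) ⟩
  f zero                                             ∎
·-δ {suc n} f (suc p) = trans (cong (_xor (f ∘ suc · δ p)) (∧-zeroʳ (f zero))) (·-δ (f ∘ suc) p)

parityCut⇔rowsOrthogonal : ∀ {n} (G : Graph n) (U : Subset n) →
                           IsGeneralizedParityCut G U ⇔ (∀ v → (adj G v · U) ≡ false)
parityCut⇔rowsOrthogonal G U = mk⇔
  (λ cut v → trans (sym (isOdd-count (λ u → adj G v u ∧ U u))) (Equivalence.to (Even⇔isOdd≡false _) (cut v)))
  (λ orth v → Equivalence.from (Even⇔isOdd≡false _) (trans (isOdd-count (λ u → adj G v u ∧ U u)) (orth v)))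

map-HasRootedParityCutPair : ∀ {n} (G H : Graph n) {x y : Fin n} (Φ : Subset n → Subset n) →
  (∀ U → IsGeneralizedParityCut G U → IsGeneralizedParityCut H (Φ U)) →
  (∀ U → Φ U x ≡ U x) → (∀ U → Φ U y ≡ U y) →
  HasRootedParityCutPair G x y → HasRootedParityCutPair H x y
map-HasRootedParityCutPair _ _ Φ Φ-cut Φx Φy ((V₁ , cut₁ , V₁x , V₁y) , (V₂ , cut₂ , V₂x , V₂y)) =
  (Φ V₁ , Φ-cut V₁ cut₁ , trans (Φx V₁) V₁x , trans (Φy V₁) V₁y) ,
  (Φ V₂ , Φ-cut V₂ cut₂ , trans (Φx V₂) V₂x , trans (Φy V₂) V₂y)

module Gcds {n} (G : Graph n) (p q : Fin n) where

  private
    a : Fin n → Fin n → Bool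
    a = adj G

  gcdsAdj-formula : ∀ s t → gcdsAdj G p q s t ≡ (a p s ⊛ a q ⊕ a q s ⊛ a p ⊕ a s) t
  gcdsAdj-formula s t with s ≟ t
  ... | no _     = refl
  ... | yes refl = sym (cong₂ _xor_ (trans (cong ((a p s ∧ a q s) xor_) (∧-comm (a q s) (a p s)))
                                           (xor-same (a p s ∧ a q s)))
                                    (adj-irrefl G s))

  module Transfer (G' : Graph n) (G'≡gcds : ∀ s t → adj G' s t ≡ gcdsAdj G p q s t) where

    gcdsRow-· : ∀ v U → (adj G' v · U) ≡ ((a p v ∧ (a q · U)) xor (a q v ∧ (a p · U))) xor (a v · U)
    gcdsRow-· v U = begin
      (adj G' v · U)                                            ≡⟨ sum-cong-≗ (λ u → cong (_∧ U u) (trans (G'≡gcds v u) (gcdsAdj-formula v u))) ⟩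
      (a p v ⊛ a q ⊕ a q v ⊛ a p ⊕ a v · U)                     ≡⟨ ·-distribˡ-⊕ (a p v ⊛ a q ⊕ a q v ⊛ a p) (a v) U ⟩
      (a p v ⊛ a q ⊕ a q v ⊛ a p · U) xor (a v · U)             ≡⟨ cong (_xor (a v · U)) (·-distribˡ-⊕ (a p v ⊛ a q) (a q v ⊛ a p) U) ⟩
      ((a p v ⊛ a q · U) xor (a q v ⊛ a p · U)) xor (a v · U)   ≡⟨ cong (_xor (a v · U)) (cong₂ _xor_ (·-scaleˡ (a p v) (a q) U) (·-scaleˡ (a q v) (a p) U)) ⟩
      ((a p v ∧ (a q · U)) xor (a q v ∧ (a p · U))) xor (a v · U) ∎

    gcds-preserves-parityCut : ∀ U → IsGeneralizedParityCut G U → IsGeneralizedParityCut G' U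
    gcds-preserves-parityCut U cut = Equivalence.from (parityCut⇔rowsOrthogonal G' U) λ v →
      trans (gcdsRow-· v U)
            (cong₂ _xor_ (cong₂ _xor_ (trans (cong (a p v ∧_) (orth q)) (∧-zeroʳ (a p v)))
                                      (trans (cong (a q v ∧_) (orth p)) (∧-zeroʳ (a q v))))
                         (orth v))
      where
      orth : ∀ w → (a w · U) ≡ false
      orth = Equivalence.to (parityCut⇔rowsOrthogonal G U) cut

    correction : Subset n → Subset n
    correction U = U ⊕ ((a q · U) ⊛ δ p ⊕ (a p · U) ⊛ δ q)

    ·-correction : ∀ v U → (a v · correction U) ≡ (adj G' v · U)
    ·-correction v U = begin
      (a v · U ⊕ (β ⊛ δ p ⊕ α ⊛ δ q))                         ≡⟨ ·-distribʳ-⊕ (a v) U _ ⟩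
      (a v · U) xor (a v · β ⊛ δ p ⊕ α ⊛ δ q)                 ≡⟨ cong ((a v · U) xor_) (·-distribʳ-⊕ (a v) (β ⊛ δ p) (α ⊛ δ q)) ⟩
      (a v · U) xor ((a v · β ⊛ δ p) xor (a v · α ⊛ δ q))     ≡⟨ cong ((a v · U) xor_) (cong₂ _xor_ (·-scaleʳ β (a v) (δ p)) (·-scaleʳ α (a v) (δ q))) ⟩
      (a v · U) xor ((β ∧ (a v · δ p)) xor (α ∧ (a v · δ q))) ≡⟨ cong ((a v · U) xor_) (cong₂ _xor_ (cong (β ∧_) (·-δ (a v) p)) (cong (α ∧_) (·-δ (a v) q))) ⟩
      (a v · U) xor ((β ∧ a v p) xor (α ∧ a v q))             ≡⟨ cong ((a v · U) xor_) (cong₂ _xor_ (swap β v p) (swap α v q)) ⟩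
      (a v · U) xor ((a p v ∧ β) xor (a q v ∧ α))             ≡⟨ xor-comm (a v · U) _ ⟩
      ((a p v ∧ β) xor (a q v ∧ α)) xor (a v · U)             ≡⟨ gcdsRow-· v U ⟨
      (adj G' v · U)                                          ∎
      where
      α β : Bool
      α = a p · U
      β = a q · U
      swap : ∀ c v w → c ∧ a v w ≡ a w v ∧ c
      swap c v w = trans (∧-comm c (a v w)) (cong (_∧ c) (adj-sym G v w))

    correction-parityCut : ∀ U → IsGeneralizedParityCut G' U → IsGeneralizedParityCut G (correction U)
    correction-parityCut U cut = Equivalence.from (parityCut⇔rowsOrthogonal G (correction U)) λ v →
      trans (·-correction v U) (Equivalence.to (parityCut⇔rowsOrthogonal G' U) cut v)

    correction-≢ : ∀ U x → x ≢ p → x ≢ q → correction U x ≡ U x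
    correction-≢ U x x≢p x≢q = begin
      U x xor (((a q · U) ∧ does (x ≟ p)) xor ((a p · U) ∧ does (x ≟ q)))
        ≡⟨ cong (U x xor_) (cong₂ _xor_ (vanish (a q · U) (x ≟ p) x≢p) (vanish (a p · U) (x ≟ q) x≢q)) ⟩
      U x xor false
        ≡⟨ xor-identityʳ (U x) ⟩
      U x ∎
      where
      vanish : ∀ c {w} (x≟w : Dec (x ≡ w)) → x ≢ w → c ∧ does x≟w ≡ false
      vanish c x≟w x≢w = trans (cong (c ∧_) (dec-false x≟w x≢w)) (∧-zeroʳ c)

mainTheorem15 : ∀ {n} (T : TwoRootedGraph n) (p q : Fin n) →
    p ≢ root₁ T → p ≢ root₂ T → q ≢ root₁ T → q ≢ root₂ T →
    adj (graph T) p q ≡ true →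
    (G' : Graph n) → (∀ s t → adj G' s t ≡ gcdsAdj (graph T) p q s t) →
    HasRootedParityCutPair (graph T) (root₁ T) (root₂ T) ⇔ HasRootedParityCutPair G' (root₁ T) (root₂ T)
mainTheorem15 T p q p≢x p≢y q≢x q≢y _ G' G'≡gcds = mk⇔
  (map-HasRootedParityCutPair (graph T) G' id gcds-preserves-parityCut (λ _ → refl) (λ _ → refl))
  (map-HasRootedParityCutPair G' (graph T) correction correction-parityCut
     (λ U → correction-≢ U (root₁ T) (≢-sym p≢x) (≢-sym q≢x))
     (λ U → correction-≢ U (root₂ T) (≢-sym p≢y) (≢-sym q≢y)))
  where
  open Gcds.Transfer (graph T) p q G' G'≡gcds
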